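{- Let $\lambda$ be a partition with $m$ parts (zero parts allowed), $\alpha$ a composition and $T\in\mathfrak{T}_\alpha^\lambda$. If $Y(T)$ contains a nefarious cell, then $\Theta(Y(T))\ne Y(T)$.
   Context: $\mathrm{Id}=(1,\dots,m)$. A skew immaculate tableau of inner shape $\alpha$ and outer shape a composition $\gamma$ (with $\ell(\gamma)\ge\ell(\alpha)$, $\gamma_i\ge\alpha_i$, $\alpha_i=0$ beyond $\ell(\alpha)$) is a filling of cells $(i,j)$, $\alpha_i<j\le\gamma_i$ (row $i$ from top) by positive integers, rows weakly increasing left to right, column-$1$ entries strictly increasing top to bottom; $c(T)$ is its content vector. $\mathfrak{T}_\alpha^\lambda$: such tableaux with entries in $\{1,\dots,m\}$ for which $\sigma(T):=c(T)-\lambda+\mathrm{Id}$ is (the one-line notation of) a permutation in $S_m$. $Y(T)$: left-justified array with rows $1,\dots,m$ (possibly empty) where each cell of $T$ in row $i$ with entry $r$ contributes an entry $i$ to row $\sigma(T)(r)$, rows sorted weakly increasing. Nefarious cells: in such an array, a cell $x$ in row $r+1\ge2$, column $c$, with entry $a$ is nefarious if either row $r$ has fewer than $c$ cells, or the cell in row $r$, column $c$ has entry $b\ge a$. The most nefarious cell is, among nefarious cells in the leftmost column containing a nefarious cell, the bottom-most one. The map $\Theta$: if the array has no nefarious cell, $\Theta$ fixes it. Otherwise let the most nefarious cell be in row $r+1$, column $c$; write row $r$ as $(p_1,\dots,p_L)$ and row $r+1$ as $(q_1,\dots,q_M)$. If $L\ge c$, replace row $r$ by $(p_1,\dots,p_{c-1},q_{c+1},\dots,q_M)$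 and row $r+1$ by $(q_1,\dots,q_c,p_c,\dots,p_L)$. If $L<c$, replace row $r$ by $(p_1,\dots,p_L,q_{c+1},\dots,q_M)$ and row $r+1$ by $(q_1,\dots,q_c)$. Other rows are unchanged. -}

module Defs where

open import Data.Nat using (ℕ; zero; suc; _+_; _∸_; _≤_; _<_; _≥_; _≤ᵇ_; _≟_)
open import Data.Nat.Properties using (≤-decTotalOrder)
open import Data.Integer as ℤ using (ℤ; +_)
open import Data.Bool using (Bool; true; false; if_then_else_)
open import Data.Maybe using (Maybe; just; nothing)
open import Data.Product using (_×_; _,_; ∃)
open import Data.Sum using (_⊎_)
open import Data.List using (List; []; _∷_; map; concat; concatMap; filter; length;
  applyUpTo; zip; take; drop; _++_; reverse; foldr)
open import Data.List.Relation.Unary.All using (All)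
open import Data.List.Relation.Unary.Linked using (Linked)
open import Data.List.Relation.Binary.Permutation.Propositional using (_↭_)
open import Relation.Binary.PropositionalEquality using (_≡_)
open import Data.List.Sort ≤-decTotalOrder using (sort)

-- nth xs k : the k-th element (1-indexed); nothing if out of range (or k = 0)
nth : {A : Set} → List A → ℕ → Maybe A
nth []       _             = nothing
nth (x ∷ xs) zero          = nothing
nth (x ∷ xs) (suc zero)    = just x
nth (x ∷ xs) (suc (suc k)) = nth xs (suc k)

-- k-th entry (1-indexed) of a list of naturals, 0 beyond the end
at : List ℕ → ℕ → ℕ
at xs k with nth xs k
... | just x  = x
... | nothing = 0

oneTo : ℕ → List ℕ
oneTo n = applyUpTo suc n

indexed : {A : Set} → List A → List (ℕ × A)
indexed xs = zip (oneTo (length xs)) xs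

-- Arrays (left-justified, rows listed top to bottom; row 1 first)

Array : Set
Array = List (List ℕ)

row : Array → ℕ → List ℕ
row A k with nth A k
... | just r  = r
... | nothing = []

entry : Array → ℕ → ℕ → Maybe ℕ
entry A k c = nth (row A k) c

setRow : Array → ℕ → List ℕ → Array
setRow []       _             _ = []
setRow (x ∷ xs) zero          _ = x ∷ xs
setRow (x ∷ xs) (suc zero)    r = r ∷ xs
setRow (x ∷ xs) (suc (suc k)) r = x ∷ setRow xs (suc k) r

Nefarious : Array → ℕ → ℕ → Set
Nefarious A k c =
  2 ≤ k × 1 ≤ c ×
  ∃ λ a → entry A k c ≡ just a ×
    (length (row A (k ∸ 1)) < c ⊎ ∃ λ b → entry A (k ∸ 1) c ≡ just b × a ≤ b)

HasNefarious : Array → Set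
HasNefarious A = ∃ λ k → ∃ λ c → Nefarious A k c

-- boolean test (used to locate the most nefarious cell); for k ≥ 2, c ≥ 1
-- the absence of the cell (k-1, c) is exactly  length (row (k-1)) < c
isNefᵇ : Array → ℕ → ℕ → Bool
isNefᵇ A k c with entry A k c
... | nothing = false
... | just a with entry A (k ∸ 1) c
...   | nothing = true
...   | just b  = a ≤ᵇ b

firstJust : {B : Set} → (ℕ → Maybe B) → List ℕ → Maybe B
firstJust f []       = nothing
firstJust f (x ∷ xs) with f x
... | just y  = just y
... | nothing = firstJust f xs

maxLen : Array → ℕ
maxLen A = foldr (λ r n → length r Data.Nat.⊔ n) 0 A

-- the most nefarious cell (row, column): leftmost column containing a
-- nefarious cell, and the bottom-most nefarious cell in that column
mostNefarious : Array → Maybe (ℕ × ℕ)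
mostNefarious A =
  firstJust
    (λ c → firstJust (λ k → if isNefᵇ A k c then just (k , c) else nothing)
                     (reverse (drop 1 (oneTo (length A)))))   -- k = len A, ..., 2
    (oneTo (maxLen A))

Θ : Array → Array
Θ A with mostNefarious A
... | nothing      = A
... | just (k , c) =
  let P = row A (k ∸ 1)
      Q = row A k
      L = length P
  in if c ≤ᵇ L
     then setRow (setRow A (k ∸ 1) (take (c ∸ 1) P ++ drop c Q)) k (take c Q ++ drop (c ∸ 1) P)
     else setRow (setRow A (k ∸ 1) (P ++ drop c Q)) k (take c Q)

-- Skew immaculate tableaux of inner shape α
-- A tableau T is given by its rows (top to bottom), each row being the list of
-- its entries left to right; row i occupies columns α_i + 1, ..., γ_i, so the
-- outer shape is  γ_i = α_i + length (row i).

Composition : List ℕ → Set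
Composition α = All (λ a → 0 < a) α

Partition : List ℕ → Set
Partition λ' = Linked _≥_ λ'

outer : List ℕ → Array → List ℕ
outer α T = map (λ { (i , r) → at α i + length r }) (indexed T)

-- entries of column 1, top to bottom: row i has a column-1 cell iff
-- α_i < 1 ≤ γ_i, i.e. α_i = 0 and the row is nonempty
column1 : List ℕ → Array → List ℕ
column1 α T = concatMap cell (indexed T)
  where
  cell : ℕ × List ℕ → List ℕ
  cell (i , [])    = []
  cell (i , x ∷ r) = if at α i ≤ᵇ 0 then x ∷ [] else []

IsSkewImmaculate : List ℕ → Array → Set
IsSkewImmaculate α T =
  length α ≤ length T ×
  Composition (outer α T) ×
  All (Linked _≤_) T ×
  Linked _<_ (column1 α T)

content : Array → ℕ → ℕ
content T r = length (filter (λ e → e ≟ r) (concat T))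

σℤ : List ℕ → Array → ℕ → ℤ
σℤ λ' T r = (+ content T r) ℤ.+ (+ r) ℤ.- (+ at λ' r)

-- the same value as a natural number (agrees with σℤ on 𝔗 since there σ(T)(r) ≥ 1)
σ : List ℕ → Array → ℕ → ℕ
σ λ' T r = content T r + r ∸ at λ' r

InFrakT : ℕ → List ℕ → List ℕ → Array → Set
InFrakT m λ' α T =
  IsSkewImmaculate α T ×
  All (All (λ e → 1 ≤ e × e ≤ m)) T ×
  map (σℤ λ' T) (oneTo m) ↭ map +_ (oneTo m)

-- Y(T): rows 1..m; a cell of T in row i with entry r contributes i to row σ(T)(r);
-- each row sorted weakly increasing
Y : ℕ → List ℕ → Array → Array
Y m λ' T = map rowY (oneTo m)
  where
  rowY : ℕ → List ℕ
  rowY j = sort (concatMap (λ { (i , r) → map (λ _ → i) (filter (λ e → σ λ' T e ≟ j) r) })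
                           (indexed T))

-- Θ only changes rows r and r + 1 around the most nefarious cell (r + 1, c), and in
-- both of its cases the new row r + 1 has exactly one cell more than the old row r,
-- of length L: if c ≤ L it has c + (L − c + 1) cells, and if L < c then c = L + 1,
-- since otherwise (r + 1, L + 1) would be a nefarious cell further left.  So Θ can
-- fix an array with a nefarious cell only if some row is one cell longer than the
-- row above it.  In Y(T) this never happens: if σ(e) = j + 1 and σ(e') = j, rows
-- j + 1 and j have lengths c_e and c_e', and c_e = c_e' + 1 would force
-- e − λ_e = e' − λ_e', impossible for e ≠ e' because λ is weakly decreasing.
module Submission where

open import Defs
open import Data.Bool using (true; false; if_then_else_)
open import Data.Bool.Properties using (T-≡)
open import Data.Empty using (⊥; ⊥-elim)
open import Data.Integer as ℤ using (ℤ; +_)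
import Data.Integer.Properties as ℤ
open import Data.List
  using (List; []; _∷_; map; length; applyUpTo; take; drop; _++_; reverse; concat; concatMap; zip; filter)
open import Data.List.Membership.Propositional using (_∈_)
open import Data.List.Membership.Propositional.Properties using (∈-applyUpTo⁺; ∈-applyUpTo⁻; ∈-map⁺; ∈-map⁻)
open import Data.List.Properties
  using (length-take; length-drop; length-++; length-map; length-applyUpTo; filter-++)
open import Data.List.Relation.Binary.Permutation.Propositional using (_↭_; ↭-sym; ↭⇒↭ₛ)
open import Data.List.Relation.Binary.Permutation.Propositional.Properties using (∈-resp-↭; ↭-length)
import Data.List.Relation.Binary.Permutation.Setoid.Properties as PermutationSetoid
open import Data.List.Relation.Unary.All as All using (All; []; _∷_)
open import Data.List.Relation.Unary.All.Properties using (concat⁺)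
open import Data.List.Relation.Unary.AllPairs using (_∷_)
open import Data.List.Relation.Unary.Any using (here; there)
open import Data.List.Relation.Unary.Any.Properties using (reverse⁺; reverse⁻)
open import Data.List.Relation.Unary.Linked as Linked using (Linked; _∷_)
open import Data.List.Relation.Unary.Unique.Propositional using (Unique)
import Data.List.Relation.Unary.Unique.Propositional.Properties as Unique
open import Data.Maybe using (Maybe; just; nothing; fromMaybe)
open import Data.Nat using (ℕ; zero; suc; _+_; _∸_; _≤_; _<_; _≥_; _>_; _≤ᵇ_; z≤n; s≤s)
open import Data.Nat.Properties
open import Data.List.Sort ≤-decTotalOrder using (sort-↭)
open import Data.Product using (_×_; _,_; ∃; proj₁; proj₂)
open import Data.Sum using (inj₁; inj₂)
open import Level using (0ℓ)
open import Function using (_∘_; _⇔_; mk⇔; Equivalence)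
open import Relation.Binary using (Tri; tri<; tri≈; tri>)
open import Relation.Binary.PropositionalEquality
open import Relation.Nullary using (¬_; yes; no; ofʸ; ofⁿ)
open import Relation.Unary using (Pred; Decidable)

nth-just⇒inRange : {A : Set} (xs : List A) (k : ℕ) {a : A} →
  nth xs k ≡ just a → 1 ≤ k × k ≤ length xs
nth-just⇒inRange []       k             ()
nth-just⇒inRange (x ∷ xs) zero          ()
nth-just⇒inRange (x ∷ xs) (suc zero)    _  = s≤s z≤n , s≤s z≤n
nth-just⇒inRange (x ∷ xs) (suc (suc k)) eq = s≤s z≤n , s≤s (proj₂ (nth-just⇒inRange xs (suc k) eq))

nth-inRange : {A : Set} (xs : List A) (k : ℕ) → 1 ≤ k → k ≤ length xs → ∃ λ a → nth xs k ≡ just a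
nth-inRange (x ∷ xs) (suc zero)    _ _         = x , refl
nth-inRange (x ∷ xs) (suc (suc k)) _ (s≤s k≤n) = nth-inRange xs (suc k) (s≤s z≤n) k≤n

nth-outOfRange : {A : Set} (xs : List A) (k : ℕ) → length xs < k → nth xs k ≡ nothing
nth-outOfRange []       k             _         = refl
nth-outOfRange (x ∷ xs) (suc (suc k)) (s≤s n<k) = nth-outOfRange xs (suc k) n<k

nth-map-applyUpTo : {A : Set} (f : ℕ → A) (g : ℕ → ℕ) (n i : ℕ) → i < n →
  nth (map f (applyUpTo g n)) (suc i) ≡ just (f (g i))
nth-map-applyUpTo f g (suc n) zero    _         = refl
nth-map-applyUpTo f g (suc n) (suc i) (s≤s i<n) = nth-map-applyUpTo f (g ∘ suc) n i i<n

at-nth : (xs : List ℕ) (k : ℕ) → at xs k ≡ fromMaybe 0 (nth xs k)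
at-nth xs k with nth xs k
... | just _  = refl
... | nothing = refl

row-nth : (A : Array) (k : ℕ) → row A k ≡ fromMaybe [] (nth A k)
row-nth A k with nth A k
... | just _  = refl
... | nothing = refl

∈-oneTo⁺ : ∀ {n x} → 1 ≤ x → x ≤ n → x ∈ oneTo n
∈-oneTo⁺ {x = suc x} _ x<n = ∈-applyUpTo⁺ suc x<n

∈-oneTo⁻ : ∀ {n x} → x ∈ oneTo n → 1 ≤ x × x ≤ n
∈-oneTo⁻ x∈ with ∈-applyUpTo⁻ suc x∈
... | _ , i<n , refl = s≤s z≤n , i<n

length-setRow : (A : Array) (k : ℕ) (r : List ℕ) → length (setRow A k r) ≡ length A
length-setRow []       k             r = refl
length-setRow (x ∷ A) zero          r = refl
length-setRow (x ∷ A) (suc zero)    r = refl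
length-setRow (x ∷ A) (suc (suc k)) r = cong suc (length-setRow A (suc k) r)

row-setRow : (A : Array) (k : ℕ) (r : List ℕ) → 1 ≤ k → k ≤ length A → row (setRow A k r) k ≡ r
row-setRow A k r 1≤k k≤n = trans (row-nth (setRow A k r) k) (cong (fromMaybe []) (nth-setRow A k 1≤k k≤n))
  where
  nth-setRow : (A : Array) (k : ℕ) → 1 ≤ k → k ≤ length A → nth (setRow A k r) k ≡ just r
  nth-setRow (x ∷ A) (suc zero)    _ _         = refl
  nth-setRow (x ∷ A) (suc (suc k)) _ (s≤s k≤n) = nth-setRow A (suc k) (s≤s z≤n) k≤n

row-map-oneTo : (f : ℕ → List ℕ) (n j : ℕ) → 1 ≤ j → j ≤ n → row (map f (oneTo n)) j ≡ f j
row-map-oneTo f n (suc j) _ j<n = trans (row-nth (map f (oneTo n)) (suc j)) (cong (fromMaybe []) (nth-map-applyUpTo f suc n j j<n))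

length-row≤maxLen : (A : Array) (k : ℕ) → length (row A k) ≤ maxLen A
length-row≤maxLen A k rewrite row-nth A k = go A k
  where
  go : (A : Array) (k : ℕ) → length (fromMaybe [] (nth A k)) ≤ maxLen A
  go []      k             = z≤n
  go (r ∷ A) zero          = z≤n
  go (r ∷ A) (suc zero)    = m≤m⊔n (length r) (maxLen A)
  go (r ∷ A) (suc (suc k)) = ≤-trans (go A (suc k)) (m≤n⊔m (length r) (maxLen A))

nonemptyRow⇒inRange : (A : Array) (k : ℕ) → 1 ≤ length (row A k) → k ≤ length A
nonemptyRow⇒inRange A k 1≤len rewrite row-nth A k with nth A k in eq
... | just _  = proj₂ (nth-just⇒inRange A k eq)
... | nothing = ⊥-elim (1+n≰n 1≤len)

entry-just⇒inRange : (A : Array) (k c : ℕ) {a : ℕ} →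
  entry A k c ≡ just a → 1 ≤ c × c ≤ length (row A k) × k ≤ length A
entry-just⇒inRange A k c eq with nth-just⇒inRange (row A k) c eq
... | 1≤c , c≤len = 1≤c , c≤len , nonemptyRow⇒inRange A k (≤-trans 1≤c c≤len)

firstJust-nothing : {B : Set} (f : ℕ → Maybe B) (xs : List ℕ) →
  firstJust f xs ≡ nothing → ∀ {x} → x ∈ xs → f x ≡ nothing
firstJust-nothing f (y ∷ xs) eq x∈ with f y in fy
firstJust-nothing f (y ∷ xs) eq (here refl) | nothing = fy
firstJust-nothing f (y ∷ xs) eq (there x∈)  | nothing = firstJust-nothing f xs eq x∈

firstJust-just : {B : Set} (f : ℕ → Maybe B) (xs : List ℕ) {y : B} →
  firstJust f xs ≡ just y → ∃ λ x → x ∈ xs × f x ≡ just y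
firstJust-just f (x ∷ xs) eq with f x in fx
firstJust-just f (x ∷ xs) refl | just _ = x , here refl , fx
... | nothing with x′ , x′∈ , fx′ ← firstJust-just f xs eq = x′ , there x′∈ , fx′

firstJust-applyUpTo-just : {B : Set} (f : ℕ → Maybe B) (g : ℕ → ℕ) (n : ℕ) {y : B} →
  firstJust f (applyUpTo g n) ≡ just y →
  ∃ λ i → f (g i) ≡ just y × (∀ {i′} → i′ < i → f (g i′) ≡ nothing)
firstJust-applyUpTo-just f g (suc n) eq with f (g 0) in fg0
firstJust-applyUpTo-just f g (suc n) refl | just _ = 0 , fg0 , λ ()
... | nothing with i , fgi , before ← firstJust-applyUpTo-just f (g ∘ suc) n eq = suc i , fgi , before′
  where
  before′ : ∀ {i′} → i′ < suc i → f (g i′) ≡ nothing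
  before′ {zero}   _         = fg0
  before′ {suc i′} (s≤s i′<i) = before i′<i

lowerRows : Array → List ℕ
lowerRows A = reverse (drop 1 (oneTo (length A)))

∈-lowerRows⁺ : (A : Array) {k : ℕ} → 2 ≤ k → k ≤ length A → k ∈ lowerRows A
∈-lowerRows⁺ A {suc zero}    (s≤s ()) _
∈-lowerRows⁺ A {suc (suc k)} _ k≤n = reverse⁺ (go (length A) k≤n)
  where
  go : ∀ n → suc (suc k) ≤ n → suc (suc k) ∈ drop 1 (oneTo n)
  go (suc n) (s≤s k<n) = ∈-applyUpTo⁺ (suc ∘ suc) k<n

∈-lowerRows⁻ : (A : Array) {k : ℕ} → k ∈ lowerRows A → 2 ≤ k × k ≤ length A
∈-lowerRows⁻ A k∈ = go (length A) (reverse⁻ k∈)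
  where
  go : ∀ n {k} → k ∈ drop 1 (oneTo n) → 2 ≤ k × k ≤ n
  go (suc n) k∈ with ∈-applyUpTo⁻ (suc ∘ suc) k∈
  ... | i , i<n , refl = s≤s (s≤s z≤n) , s≤s i<n

isNefᵇ-noCellAbove : (A : Array) {k c a : ℕ} →
  entry A k c ≡ just a → entry A (k ∸ 1) c ≡ nothing → isNefᵇ A k c ≡ true
isNefᵇ-noCellAbove A {k} {c} eqₖ eqₖ₋₁ with entry A k c | eqₖ
... | just _ | refl with entry A (k ∸ 1) c | eqₖ₋₁
...   | nothing | refl = refl

isNefᵇ-cellAbove : (A : Array) {k c a b : ℕ} →
  entry A k c ≡ just a → entry A (k ∸ 1) c ≡ just b → a ≤ b → isNefᵇ A k c ≡ true
isNefᵇ-cellAbove A {k} {c} {a} {b} eqₖ eqₖ₋₁ a≤b with entry A k c | eqₖ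
... | just _ | refl with entry A (k ∸ 1) c | eqₖ₋₁
...   | just _ | refl = Equivalence.to T-≡ (≤⇒≤ᵇ a≤b)

Nefarious⇒isNefᵇ : (A : Array) {k c : ℕ} → Nefarious A k c → isNefᵇ A k c ≡ true
Nefarious⇒isNefᵇ A {k} {c} (_ , _ , _ , eqₖ , inj₁ c>len) =
  isNefᵇ-noCellAbove A eqₖ (nth-outOfRange (row A (k ∸ 1)) c c>len)
Nefarious⇒isNefᵇ A (_ , _ , _ , eqₖ , inj₂ (_ , eqₖ₋₁ , a≤b)) = isNefᵇ-cellAbove A eqₖ eqₖ₋₁ a≤b

isNefᵇ⇒entry : (A : Array) (k c : ℕ) → isNefᵇ A k c ≡ true → ∃ λ a → entry A k c ≡ just a
isNefᵇ⇒entry A k c isNef with entry A k c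
... | just a = a , refl

-- mostNefarious A unfolds to firstJust (λ c → firstJust (candidate A c) (lowerRows A)) (oneTo (maxLen A)).
candidate : Array → ℕ → ℕ → Maybe (ℕ × ℕ)
candidate A c k = if isNefᵇ A k c then just (k , c) else nothing

Nefarious⇒candidate : (A : Array) {k c : ℕ} → Nefarious A k c → candidate A c k ≡ just (k , c)
Nefarious⇒candidate A nef rewrite Nefarious⇒isNefᵇ A nef = refl

Nefarious⇒inRange : (A : Array) {k c : ℕ} → Nefarious A k c → k ∈ lowerRows A × c ∈ oneTo (maxLen A)
Nefarious⇒inRange A {k} {c} (2≤k , _ , _ , eqₖ , _) with entry-just⇒inRange A k c eqₖ
... | 1≤c , c≤len , k≤n = ∈-lowerRows⁺ A 2≤k k≤n , ∈-oneTo⁺ 1≤c (≤-trans c≤len (length-row≤maxLen A k))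

record MostNefarious (A : Array) (k c : ℕ) : Set where
  field
    2≤k      : 2 ≤ k
    k≤length : k ≤ length A
    1≤c      : 1 ≤ c
    c≤length : c ≤ length (row A k)
    leftmost : ∀ {k′ c′} → c′ < c → ¬ Nefarious A k′ c′

mostNefarious-sound : (A : Array) {k c : ℕ} → mostNefarious A ≡ just (k , c) → MostNefarious A k c
mostNefarious-sound A eq
  with i , found , before ← firstJust-applyUpTo-just (λ c → firstJust (candidate A c) (lowerRows A)) suc (maxLen A) eq
  with k , k∈ , hit ← firstJust-just (candidate A (suc i)) (lowerRows A) found
  with isNefᵇ A k (suc i) in isNef
... | true with refl ← hit = record
  { 2≤k      = proj₁ (∈-lowerRows⁻ A k∈)
  ; k≤length = proj₂ (∈-lowerRows⁻ A k∈)
  ; 1≤c      = s≤s z≤n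
  ; c≤length = proj₁ (proj₂ (entry-just⇒inRange A k (suc i) (proj₂ (isNefᵇ⇒entry A k (suc i) isNef))))
  ; leftmost = leftmost
  }
  where
  leftmost : ∀ {k′ c′} → c′ < suc i → ¬ Nefarious A k′ c′
  leftmost {k′} {suc c′} (s≤s c′<i) nef with Nefarious⇒inRange A nef
  ... | k′∈ , _ with () ← trans (sym (Nefarious⇒candidate A nef))
                             (firstJust-nothing (candidate A (suc c′)) (lowerRows A) (before c′<i) k′∈)

mostNefarious-complete : (A : Array) → HasNefarious A → ∃ λ kc → mostNefarious A ≡ just kc
mostNefarious-complete A (k , c , nef) with mostNefarious A in eq
... | just kc = kc , refl
... | nothing with k∈ , c∈ ← Nefarious⇒inRange A nef
  with () ← trans (sym (Nefarious⇒candidate A nef))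
                  (firstJust-nothing (candidate A c) (lowerRows A)
                    (firstJust-nothing (λ c → firstJust (candidate A c) (lowerRows A)) (oneTo (maxLen A)) eq c∈) k∈)

m+[n∸[m∸1]]≡1+n : ∀ {m n} → 1 ≤ m → m ≤ n → m + (n ∸ (m ∸ 1)) ≡ suc n
m+[n∸[m∸1]]≡1+n {suc m} _ m<n = cong suc (m+[n∸m]≡n (<⇒≤ m<n))

length-take-≤ : {A : Set} {n : ℕ} {xs : List A} → n ≤ length xs → length (take n xs) ≡ n
length-take-≤ {n = n} {xs} n≤len = trans (length-take n xs) (m≤n⇒m⊓n≡m n≤len)

NoRowGrowsByOne : Array → Set
NoRowGrowsByOne A = ∀ k → 2 ≤ k → k ≤ length A → length (row A k) ≢ suc (length (row A (k ∸ 1)))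

module _ {A : Array} {k c : ℕ} (most : MostNefarious A k c) where
  open MostNefarious most

  overhang⇒c≡1+length : length (row A (k ∸ 1)) < c → c ≡ suc (length (row A (k ∸ 1)))
  overhang⇒c≡1+length L<c with m≤n⇒m<n∨m≡n L<c
  ... | inj₂ 1+L≡c = sym 1+L≡c
  ... | inj₁ 1+L<c = ⊥-elim (leftmost 1+L<c nef)
    where
    L = length (row A (k ∸ 1))
    cell = nth-inRange (row A k) (suc L) (s≤s z≤n) (≤-trans (<⇒≤ 1+L<c) c≤length)
    nef : Nefarious A k (suc L)
    nef = 2≤k , s≤s z≤n , proj₁ cell , proj₂ cell , inj₁ ≤-refl

  row-setRow-setRow : (R₁ R₂ : List ℕ) → row (setRow (setRow A (k ∸ 1) R₁) k R₂) k ≡ R₂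
  row-setRow-setRow R₁ R₂ =
    row-setRow (setRow A (k ∸ 1) R₁) k R₂ (≤-trans (s≤s z≤n) 2≤k) (subst (k ≤_) (sym (length-setRow A (k ∸ 1) R₁)) k≤length)

length-row-Θ : (A : Array) {k c : ℕ} → mostNefarious A ≡ just (k , c) →
  length (row (Θ A) k) ≡ suc (length (row A (k ∸ 1)))
length-row-Θ A {k} {c} eq with mostNefarious-sound A eq
... | most with mostNefarious A | eq
... | just .(k , c) | refl with c ≤ᵇ length (row A (k ∸ 1)) | ≤ᵇ-reflects-≤ c (length (row A (k ∸ 1)))
...   | true | ofʸ c≤L = begin
  length (row (setRow (setRow A (k ∸ 1) (take (c ∸ 1) P ++ drop c Q)) k (take c Q ++ drop (c ∸ 1) P)) k)
    ≡⟨ cong length (row-setRow-setRow most _ _) ⟩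
  length (take c Q ++ drop (c ∸ 1) P)
    ≡⟨ length-++ (take c Q) ⟩
  length (take c Q) + length (drop (c ∸ 1) P)
    ≡⟨ cong₂ _+_ (length-take-≤ c≤length) (length-drop (c ∸ 1) P) ⟩
  c + (length P ∸ (c ∸ 1))
    ≡⟨ m+[n∸[m∸1]]≡1+n 1≤c c≤L ⟩
  suc (length P) ∎
  where
  open MostNefarious most
  open ≡-Reasoning
  P = row A (k ∸ 1)
  Q = row A k
...   | false | ofⁿ c≰L = begin
  length (row (setRow (setRow A (k ∸ 1) (P ++ drop c Q)) k (take c Q)) k)
    ≡⟨ cong length (row-setRow-setRow most _ _) ⟩
  length (take c Q)
    ≡⟨ length-take-≤ c≤length ⟩
  c
    ≡⟨ overhang⇒c≡1+length most (≰⇒> c≰L) ⟩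
  suc (length P) ∎
  where
  open MostNefarious most
  open ≡-Reasoning
  P = row A (k ∸ 1)
  Q = row A k

Θ-moves : (A : Array) → NoRowGrowsByOne A → HasNefarious A → Θ A ≢ A
Θ-moves A noGrowth hasNef Θ≡A with (k , c) , eq ← mostNefarious-complete A hasNef =
  noGrowth k 2≤k k≤length (begin
    length (row A k)       ≡⟨ cong (λ B → length (row B k)) Θ≡A ⟨
    length (row (Θ A) k)   ≡⟨ length-row-Θ A eq ⟩
    suc (length (row A (k ∸ 1))) ∎)
  where
  open MostNefarious (mostNefarious-sound A eq)
  open ≡-Reasoning

length-Y : (m : ℕ) (λ' : List ℕ) (T : Array) → length (Y m λ' T) ≡ m
length-Y m λ' T = trans (length-map _ (oneTo m)) (length-applyUpTo suc m)

length-concatMap-labelled : {B : Set} {P : Pred ℕ 0ℓ} (P? : Decidable P) (label : ℕ × List ℕ → List B) →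
  (∀ i r → length (label (i , r)) ≡ length (filter P? r)) → (g : ℕ → ℕ) (T : Array) →
  length (concatMap label (zip (applyUpTo g (length T)) T)) ≡ length (filter P? (concat T))
length-concatMap-labelled P? label length-label g []      = refl
length-concatMap-labelled P? label length-label g (r ∷ T) = begin
  length (label (g 0 , r) ++ concatMap label (zip (applyUpTo (g ∘ suc) (length T)) T))
    ≡⟨ length-++ (label (g 0 , r)) ⟩
  length (label (g 0 , r)) + length (concatMap label (zip (applyUpTo (g ∘ suc) (length T)) T))
    ≡⟨ cong₂ _+_ (length-label (g 0) r) (length-concatMap-labelled P? label length-label (g ∘ suc) T) ⟩
  length (filter P? r) + length (filter P? (concat T))
    ≡⟨ length-++ (filter P? r) ⟨
  length (filter P? r ++ filter P? (concat T))
    ≡⟨ cong length (filter-++ P? r (concat T)) ⟨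
  length (filter P? (r ++ concat T)) ∎
  where open ≡-Reasoning

length-row-Y : (m : ℕ) (λ' : List ℕ) (T : Array) {j : ℕ} → 1 ≤ j → j ≤ m →
  length (row (Y m λ' T) j) ≡ length (filter (λ e → σ λ' T e ≟ j) (concat T))
length-row-Y m λ' T {j} 1≤j j≤m =
  trans (cong length (row-map-oneTo _ m j 1≤j j≤m))
    (trans (↭-length (sort-↭ _))
      (length-concatMap-labelled (λ e → σ λ' T e ≟ j) _
        (λ i r → length-map (λ _ → i) (filter (λ e → σ λ' T e ≟ j) r)) suc T))

+a++b-+c≡+d⇒a+b≡d+c : ∀ a b c d → (+ a) ℤ.+ (+ b) ℤ.- (+ c) ≡ + d → a + b ≡ d + c
+a++b-+c≡+d⇒a+b≡d+c a b c d eq = ℤ.+-injective (begin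
  + (a + b)                      ≡⟨ ℤ.pos-+ a b ⟩
  + a ℤ.+ + b                    ≡⟨ ℤ.+-identityʳ _ ⟨
  + a ℤ.+ + b ℤ.+ + 0            ≡⟨ cong (λ z → + a ℤ.+ + b ℤ.+ z) (ℤ.+-inverseˡ (+ c)) ⟨
  + a ℤ.+ + b ℤ.+ (ℤ.- + c ℤ.+ + c) ≡⟨ ℤ.+-assoc (+ a ℤ.+ + b) (ℤ.- + c) (+ c) ⟨
  + a ℤ.+ + b ℤ.- + c ℤ.+ + c    ≡⟨ cong (ℤ._+ + c) eq ⟩
  + d ℤ.+ + c                    ≡⟨ ℤ.pos-+ d c ⟨
  + (d + c)                      ∎)
  where open ≡-Reasoning

module _ (λ' : List ℕ) (T : Array) {e s : ℕ} (σℤe≡s : σℤ λ' T e ≡ + s) where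

  σℤ≡+⇒balance : content T e + e ≡ s + at λ' e
  σℤ≡+⇒balance = +a++b-+c≡+d⇒a+b≡d+c (content T e) e (at λ' e) s σℤe≡s

  σℤ≡+⇒σ≡ : σ λ' T e ≡ s
  σℤ≡+⇒σ≡ = trans (cong (_∸ at λ' e) σℤ≡+⇒balance) (m+n∸n≡m s (at λ' e))

Unique-map⇒injective : {A B : Set} (f : A → B) {xs : List A} → Unique (map f xs) →
  ∀ {x y} → x ∈ xs → y ∈ xs → f x ≡ f y → x ≡ y
Unique-map⇒injective f (_ ∷ _)       (here refl) (here refl) _   = refl
Unique-map⇒injective f (fx∉ ∷ _)     (here refl) (there y∈)  fx≡fy = ⊥-elim (All.lookup fx∉ (∈-map⁺ f y∈) fx≡fy)
Unique-map⇒injective f (fy∉ ∷ _)     (there x∈)  (here refl) fx≡fy = ⊥-elim (All.lookup fy∉ (∈-map⁺ f x∈) (sym fx≡fy))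
Unique-map⇒injective f (_ ∷ unique) (there x∈)  (there y∈)  fx≡fy = Unique-map⇒injective f unique x∈ y∈ fx≡fy

filter-cong-All : {A : Set} {P Q : Pred A 0ℓ} (P? : Decidable P) (Q? : Decidable Q) {xs : List A} →
  All (λ x → P x ⇔ Q x) xs → filter P? xs ≡ filter Q? xs
filter-cong-All P? Q? {[]}     []             = refl
filter-cong-All P? Q? {x ∷ xs} (Px⇔Qx ∷ rest) with P? x | Q? x
... | yes _  | yes _  = cong (x ∷_) (filter-cong-All P? Q? rest)
... | yes Px | no ¬Qx = ⊥-elim (¬Qx (Equivalence.to Px⇔Qx Px))
... | no ¬Px | yes Qx = ⊥-elim (¬Px (Equivalence.from Px⇔Qx Qx))
... | no _   | no _   = filter-cong-All P? Q? rest

EntriesIn : ℕ → Array → Set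
EntriesIn m T = All (All (λ e → 1 ≤ e × e ≤ m)) T

Partition⇒at-antitone : {λ' : List ℕ} → Partition λ' → ∀ {s t} → 1 ≤ s → s ≤ t → at λ' t ≤ at λ' s
Partition⇒at-antitone {λ'} part {s} {t} 1≤s s≤t rewrite at-nth λ' s | at-nth λ' t = go part 1≤s s≤t
  where
  go : ∀ {xs} → Linked _≥_ xs → ∀ {s t} → 1 ≤ s → s ≤ t → fromMaybe 0 (nth xs t) ≤ fromMaybe 0 (nth xs s)
  go {[]}         _          _ _ = z≤n
  go {x ∷ xs}     _          {suc zero}    {suc zero}    _ _ = ≤-refl
  go {x ∷ []}     _          {suc zero}    {suc (suc t)} _ _ = z≤n
  go {x ∷ y ∷ xs} (x≥y ∷ ys) {suc zero}    {suc (suc t)} _ _ = ≤-trans (go ys {1} {suc t} (s≤s z≤n) (s≤s z≤n)) x≥y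
  go {x ∷ xs}     xs-linked  {suc (suc s)} {suc (suc t)} _ (s≤s s≤t) = go (Linked.tail xs-linked) (s≤s z≤n) s≤t

shifted-collision : ∀ {c j e e′ a a′} → c + e ≡ j + a → c + e′ ≡ j + a′ → e < e′ → a′ ≤ a → ⊥
shifted-collision {c} {j} {e} {e′} {a} {a′} eq eq′ e<e′ a′≤a = <-irrefl refl (begin-strict
  c + e    <⟨ +-monoʳ-< c e<e′ ⟩
  c + e′   ≡⟨ eq′ ⟩
  j + a′   ≤⟨ +-monoʳ-≤ j a′≤a ⟩
  j + a    ≡⟨ eq ⟨
  c + e    ∎)
  where open ≤-Reasoning

content-step-impossible : (λ' : List ℕ) (T : Array) → Partition λ' → ∀ {e e′ j} → 1 ≤ e → 1 ≤ e′ →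
  σℤ λ' T e ≡ + suc j → σℤ λ' T e′ ≡ + j → content T e ≢ suc (content T e′)
content-step-impossible λ' T part {e} {e′} {j} 1≤e 1≤e′ σℤe≡1+j σℤe′≡j step = clash (<-cmp e e′)
  where
  balance : content T e′ + e ≡ j + at λ' e
  balance = suc-injective (trans (cong (_+ e) (sym step)) (σℤ≡+⇒balance λ' T σℤe≡1+j))
  balance′ : content T e′ + e′ ≡ j + at λ' e′
  balance′ = σℤ≡+⇒balance λ' T σℤe′≡j
  clash : Tri (e < e′) (e ≡ e′) (e > e′) → ⊥
  clash (tri< e<e′ _ _) = shifted-collision balance balance′ e<e′ (Partition⇒at-antitone part 1≤e (<⇒≤ e<e′))
  clash (tri> _ _ e>e′) = shifted-collision balance′ balance e>e′ (Partition⇒at-antitone part 1≤e′ (<⇒≤ e>e′))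
  clash (tri≈ _ refl _) = 1+n≢n (trans (sym (σℤ≡+⇒σ≡ λ' T σℤe≡1+j)) (σℤ≡+⇒σ≡ λ' T σℤe′≡j))

module _ {m : ℕ} {λ' : List ℕ} {T : Array} (σ-perm : map (σℤ λ' T) (oneTo m) ↭ map +_ (oneTo m)) where

  σℤ-surjective : ∀ {j} → j ∈ oneTo m → ∃ λ e → e ∈ oneTo m × σℤ λ' T e ≡ + j
  σℤ-surjective j∈ with e , e∈ , +j≡σℤe ← ∈-map⁻ (σℤ λ' T) (∈-resp-↭ (↭-sym σ-perm) (∈-map⁺ +_ j∈)) =
    e , e∈ , sym +j≡σℤe

  σℤ≡+σ : ∀ {e} → e ∈ oneTo m → σℤ λ' T e ≡ + σ λ' T e
  σℤ≡+σ e∈ with s , _ , σℤe≡s ← ∈-map⁻ +_ (∈-resp-↭ σ-perm (∈-map⁺ (σℤ λ' T) e∈)) =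
    trans σℤe≡s (cong +_ (sym (σℤ≡+⇒σ≡ λ' T σℤe≡s)))

  σ-injective : ∀ {x y} → x ∈ oneTo m → y ∈ oneTo m → σ λ' T x ≡ σ λ' T y → x ≡ y
  σ-injective x∈ y∈ σx≡σy =
    Unique-map⇒injective (σℤ λ' T) σℤ-unique x∈ y∈ (trans (σℤ≡+σ x∈) (trans (cong +_ σx≡σy) (sym (σℤ≡+σ y∈))))
    where
    σℤ-unique : Unique (map (σℤ λ' T) (oneTo m))
    σℤ-unique = PermutationSetoid.Unique-resp-↭ (setoid ℤ) (↭⇒↭ₛ (↭-sym σ-perm))
      (Unique.map⁺ ℤ.+-injective (Unique.applyUpTo⁺₁ suc m (λ i<j _ → <⇒≢ i<j ∘ suc-injective)))

  length-row-Y≡content : EntriesIn m T → ∀ {e j} → e ∈ oneTo m → σℤ λ' T e ≡ + j → j ∈ oneTo m →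
    length (row (Y m λ' T) j) ≡ content T e
  length-row-Y≡content entries {e} {j} e∈ σℤe≡j j∈ =
    trans (length-row-Y m λ' T (proj₁ (∈-oneTo⁻ j∈)) (proj₂ (∈-oneTo⁻ j∈)))
      (cong length (filter-cong-All (λ x → σ λ' T x ≟ j) (_≟ e) (All.map σx≡j⇔x≡e (concat⁺ entries))))
    where
    σe≡j : σ λ' T e ≡ j
    σe≡j = σℤ≡+⇒σ≡ λ' T σℤe≡j
    σx≡j⇔x≡e : ∀ {x} → 1 ≤ x × x ≤ m → (σ λ' T x ≡ j) ⇔ (x ≡ e)
    σx≡j⇔x≡e (1≤x , x≤m) = mk⇔
      (λ σx≡j → σ-injective (∈-oneTo⁺ 1≤x x≤m) e∈ (trans σx≡j (sym σe≡j)))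
      (λ { refl → σe≡j })

  Y-noRowGrowsByOne : Partition λ' → EntriesIn m T → NoRowGrowsByOne (Y m λ' T)
  Y-noRowGrowsByOne part entries (suc zero)    (s≤s ()) _ _
  Y-noRowGrowsByOne part entries (suc (suc j)) _ k≤length grows =
    let e  , e∈  , σℤe  = σℤ-surjective k∈
        e′ , e′∈ , σℤe′ = σℤ-surjective k-1∈
    in content-step-impossible λ' T part (proj₁ (∈-oneTo⁻ e∈)) (proj₁ (∈-oneTo⁻ e′∈)) σℤe σℤe′ (begin
      content T e                            ≡⟨ length-row-Y≡content entries e∈ σℤe k∈ ⟨
      length (row (Y m λ' T) (suc (suc j)))  ≡⟨ grows ⟩
      suc (length (row (Y m λ' T) (suc j)))  ≡⟨ cong suc (length-row-Y≡content entries e′∈ σℤe′ k-1∈) ⟩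
      suc (content T e′)                     ∎)
    where
    open ≡-Reasoning
    k≤m : suc (suc j) ≤ m
    k≤m = subst (suc (suc j) ≤_) (length-Y m λ' T) k≤length
    k∈ : suc (suc j) ∈ oneTo m
    k∈ = ∈-oneTo⁺ (s≤s z≤n) k≤m
    k-1∈ : suc j ∈ oneTo m
    k-1∈ = ∈-oneTo⁺ (s≤s z≤n) (<⇒≤ k≤m)

lemma7p19 : (m : ℕ) (λ' α : List ℕ) (T : Array) →
    Partition λ' → length λ' ≡ m → Composition α → InFrakT m λ' α T →
    HasNefarious (Y m λ' T) → Θ (Y m λ' T) ≢ Y m λ' T
lemma7p19 m λ' α T part _ _ (_ , entries , σ-perm) =
  Θ-moves (Y m λ' T) (Y-noRowGrowsByOne σ-perm part entries)
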